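{- Every operator $\mathbf{A}$ that is a (possibly empty) composition of operators from $\{\mathbf{S},\mathbf{R}\}$ respects $P$.
   Context: Notation and conventions. - Permutations of $[n]$ are in one-line notation, with composition $(\lambda\circ\sigma)(i)=\lambda(\sigma(i))$. - A sequence of distinct integers is identified with the permutation order-isomorphic to it; $n$ denotes the maximum entry. - $\mathrm{Av}(231)$ (resp. $\mathrm{Av}(132)$) is the set of permutations having no subsequence order-isomorphic to $231$ (resp. $132$). Operators. - $\mathbf{S}$ is stack sorting: $\mathbf{S}(\varepsilon)=\varepsilon$ and $\mathbf{S}(\alpha n\beta)=\mathbf{S}(\alpha)\mathbf{S}(\beta)n$, where $n$ is the maximum entry. - $\mathbf{R}$ is reversal. The bijection $P$. - $\alpha\oplus\beta=\alpha(\beta+|\alpha|)$ and $\alpha\ominus\beta=(\alpha+|\beta|)\beta$. - Every nonempty $\pi\in\mathrm{Av}(231)$ is uniquely $\alpha\oplus(1\ominus\beta)$ with $\alpha,\beta\in\mathrm{Av}(231)$. - $P:\mathrm{Av}(231)\to\mathrm{Av}(132)$ is the bijection defined by $P(\varepsilon)=\varepsilon$ and $P(\alpha\oplus(1\ominus\beta))=(P(\alpha)\oplus1)\ominus P(\beta)$. - For $\pi\in\mathrm{Av}(231)$ of size $n$, $\lambda_\pi$ is the permutation of $[n]$ with $P(\pi)=\lambda_\pi\circ\pi$. Trees. - A binary tree with integer-labelled vertices is decreasing if every child has a smaller label than its parent. - The in-order reading is defined recursively: it is (reading of left subtree)(root label)(reading of right subtree). - $\mathrm{T}_{\mathrm{in}}(\pi)$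 is the unique decreasing binary tree whose in-order reading is $\pi$. - For a permutation $\lambda$ and a tree $T$ labelled in $[n]$, $\lambda(T)$ is $T$ with each label $\ell$ replaced by $\lambda(\ell)$. Respecting $P$. An operator $\mathbf{A}$ (a composition of $\mathbf{S}$ and $\mathbf{R}$) respects $P$ if, for every $n$ and every $\pi\in\mathrm{Av}(231)$ of size $n$ lying in the image of $\mathbf{A}$: - (i) every permutation $\theta$ with $\mathbf{A}(\theta)=\pi$ satisfies $\mathbf{A}(\lambda_\pi\circ\theta)=P(\pi)$ and $\mathrm{T}_{\mathrm{in}}(\lambda_\pi\circ\theta)=\lambda_\pi(\mathrm{T}_{\mathrm{in}}(\theta))$; - (ii) the map $\theta\mapsto\lambda_\pi\circ\theta$ is a bijection from $\mathbf{A}^{ -1}(\pi)$ onto $\mathbf{A}^{ -1}(P(\pi))$. -}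

module Defs where

open import Data.Nat using (ℕ; zero; suc; _+_; _<_; _⊔_; _<?_; _≟_)
open import Data.Fin as Fin using (Fin)
open import Data.List using (List; []; _∷_; _++_; map; length; foldr; filter; upTo; lookup; [_])
open import Data.List.Relation.Binary.Permutation.Propositional using (_↭_)
open import Data.Product using (Σ; ∃; _×_; _,_; proj₁; proj₂)
open import Data.Unit using (⊤)
open import Relation.Nullary using (¬_; yes; no)
open import Relation.Binary.PropositionalEquality using (_≡_)

-- Permutations in one-line notation, as lists of naturals.

IsPerm : ℕ → List ℕ → Set
IsPerm n θ = θ ↭ map suc (upTo n)

-- λ(i), 1-indexed (value irrelevant outside 1..length λ)
app : List ℕ → ℕ → ℕ
app []       _             = 0
app (x ∷ xs) zero          = 0
app (x ∷ xs) (suc zero)    = x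
app (x ∷ xs) (suc (suc i)) = app xs (suc i)

_∘ₚ_ : List ℕ → List ℕ → List ℕ
λ′ ∘ₚ θ = map (app λ′) θ

maxL : List ℕ → ℕ
maxL = foldr _⊔_ 0

splitOn : ℕ → List ℕ → List ℕ × List ℕ
splitOn m [] = [] , []
splitOn m (x ∷ xs) with x ≟ m
... | yes _ = [] , xs
... | no  _ = let r = splitOn m xs in (x ∷ proj₁ r) , proj₂ r

-- Stack sorting S(α n β) = S(α) S(β) n   (fuel = length suffices)

stackFuel : ℕ → List ℕ → List ℕ
stackFuel zero    xs       = xs
stackFuel (suc k) []       = []
stackFuel (suc k) (x ∷ xs) =
  let m = maxL (x ∷ xs)
      r = splitOn m (x ∷ xs)
  in stackFuel k (proj₁ r) ++ stackFuel k (proj₂ r) ++ [ m ]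

S : List ℕ → List ℕ
S xs = stackFuel (length xs) xs

R : List ℕ → List ℕ
R = Data.List.reverse

data Op : Set where
  opS opR : Op

runOp : Op → List ℕ → List ℕ
runOp opS = S
runOp opR = R

run : List Op → List ℕ → List ℕ
run []       θ = θ
run (o ∷ os) θ = runOp o (run os θ)

Contains231 : List ℕ → Set
Contains231 xs = Σ (Fin (length xs)) λ i → Σ (Fin (length xs)) λ j → Σ (Fin (length xs)) λ k →
  (i Fin.< j) × (j Fin.< k) × (lookup xs k < lookup xs i) × (lookup xs i < lookup xs j)

Av231 : List ℕ → Set
Av231 xs = ¬ Contains231 xs

rank : List ℕ → ℕ → ℕ
rank xs x = suc (length (filter (_<? x) xs))

std : List ℕ → List ℕ
std xs = map (rank xs) xs

_⊕_ : List ℕ → List ℕ → List ℕ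
α ⊕ β = α ++ map (_+ length α) β

_⊖_ : List ℕ → List ℕ → List ℕ
α ⊖ β = map (_+ length β) α ++ β

-- For nonempty π ∈ Av(231), π = α ⊕ (1 ⊖ β) where α is the (standardised)
-- prefix before the maximum and β the standardised suffix after it.
-- P(α ⊕ (1 ⊖ β)) = (P(α) ⊕ 1) ⊖ P(β).
PFuel : ℕ → List ℕ → List ℕ
PFuel zero    xs       = xs
PFuel (suc k) []       = []
PFuel (suc k) (x ∷ xs) =
  let r = splitOn (maxL (x ∷ xs)) (x ∷ xs)
  in (PFuel k (std (proj₁ r)) ⊕ [ 1 ]) ⊖ PFuel k (std (proj₂ r))

P : List ℕ → List ℕ
P xs = PFuel (length xs) xs

IsLambda : ℕ → List ℕ → List ℕ → Set
IsLambda n π λ′ = IsPerm n λ′ × (P π ≡ λ′ ∘ₚ π)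

data Tree : Set where
  leaf : Tree
  node : Tree → ℕ → Tree → Tree

Below : ℕ → Tree → Set
Below p leaf         = ⊤
Below p (node _ x _) = x < p

Decreasing : Tree → Set
Decreasing leaf         = ⊤
Decreasing (node l x r) = Below x l × Below x r × Decreasing l × Decreasing r

inorder : Tree → List ℕ
inorder leaf         = []
inorder (node l x r) = inorder l ++ x ∷ inorder r

IsTin : List ℕ → Tree → Set
IsTin θ T = Decreasing T × inorder T ≡ θ

relabel : List ℕ → Tree → Tree
relabel λ′ leaf         = leaf
relabel λ′ (node l x r) = node (relabel λ′ l) (app λ′ x) (relabel λ′ r)

RespectsP : (List ℕ → List ℕ) → Set
RespectsP A =
  (n : ℕ) (π : List ℕ) → IsPerm n π → Av231 π →
  (∃ λ θ₀ → IsPerm n θ₀ × A θ₀ ≡ π) →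
  (λ′ : List ℕ) → IsLambda n π λ′ →
  ( ((θ : List ℕ) → IsPerm n θ → A θ ≡ π →
        (A (λ′ ∘ₚ θ) ≡ P π)
      × ((T T′ : Tree) → IsTin θ T → IsTin (λ′ ∘ₚ θ) T′ → T′ ≡ relabel λ′ T))
  -- (ii) θ ↦ λ ∘ θ is a bijection A⁻¹(π) → A⁻¹(P π)  (maps into by (i))
  × ((θ₁ θ₂ : List ℕ) → IsPerm n θ₁ → A θ₁ ≡ π → IsPerm n θ₂ → A θ₂ ≡ π →
        λ′ ∘ₚ θ₁ ≡ λ′ ∘ₚ θ₂ → θ₁ ≡ θ₂)
  × ((θ′ : List ℕ) → IsPerm n θ′ → A θ′ ≡ P π →
        ∃ λ θ → IsPerm n θ × A θ ≡ π × λ′ ∘ₚ θ ≡ θ′) )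

-- Say that x dominates y in a word when both lie in a factor whose largest entry is x.
-- Stack sorting splits a word at its maximum and recurses on both sides, so a factor of
-- the input either stays within one side or contains the maximum; hence S, and trivially R,
-- only create dominance relations. A relabelling f that is injective and dominance-monotone
-- on A(θ) is therefore so at every intermediate stage, and commutes with each step:
-- A(f ∘ θ) = f ∘ A(θ). The recursion defining P places the largest value of P(π) at the
-- position of the maximum of π and recurses on both sides, so λ_π is dominance-monotone on
-- π and its inverse is dominance-monotone on P(π) = λ_π ∘ π. This gives A(λ_π ∘ θ) = P(π),
-- the inverse map θ′ ↦ λ_π⁻¹ ∘ θ′, and, since a decreasing tree is determined by the
-- dominance order of its in-order reading, T_in(λ_π ∘ θ) = λ_π(T_in(θ)).

module Submission where

open import Defs
open import Function using (_∘_; id)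
open import Data.Nat using (ℕ; zero; suc; _+_; _≤_; _<_; _<?_; _≟_; z≤n; s≤s)
open import Data.Nat.Properties
open import Data.Product as Product using (∃; ∃₂; _×_; _,_; proj₁; proj₂; <_,_>)
open import Data.Sum as Sum using (_⊎_; inj₁; inj₂)
open import Data.List using (List; []; _∷_; _++_; map; length; reverse; zip; upTo; applyUpTo; [_])
open import Data.List.Properties
  using ( ∷-injective; ∷-injectiveˡ; ∷-injectiveʳ; ++-assoc; ++-identityʳ; ++-conicalʳ
        ; length-++; length-map; length-upTo; map-++; map-∘; map-id; map-id-local; map-applyUpTo
        ; reverse-++; reverse-map; zip-map; filter-accept; filter-reject )
open import Data.List.Membership.Propositional using (_∈_; _∉_)
open import Data.List.Membership.Propositional.Properties
  using (∈-map⁺; ∈-map⁻; ∈-++⁺ˡ; ∈-++⁺ʳ; ∈-++⁻; ∈-upTo⁻)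
open import Data.List.Relation.Unary.Any using (here; there)
open import Data.List.Relation.Unary.All as All using (All; []; _∷_)
import Data.List.Relation.Unary.All.Properties as All
open import Data.List.Relation.Binary.Permutation.Propositional
  using (_↭_; ↭-refl; ↭-sym; ↭-trans; ↭⇒↭ₛ; module PermutationReasoning)
import Data.List.Relation.Binary.Permutation.Propositional.Properties as ↭
open import Data.List.Relation.Unary.Unique.Propositional using (Unique)
open import Data.List.Relation.Unary.AllPairs as AllPairs using ([]; _∷_)
open import Data.List.Relation.Unary.Unique.Propositional.Properties
  using (Unique[x∷xs]⇒x∉xs; upTo⁺)
import Data.List.Relation.Unary.Unique.Propositional.Properties as Unique
import Data.List.Relation.Binary.Permutation.Setoid.Properties as Setoid↭
open import Data.List.Relation.Binary.Sublist.Propositional using (_⊆_; _∷ʳ_; ⊆-refl)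
open import Data.List.Relation.Binary.Sublist.Propositional.Properties
  using (filter⁺; length-mono-≤)
open import Data.Empty using (⊥-elim)
open import Data.Unit using (tt)
open import Relation.Binary.Definitions using (tri<; tri≈; tri>)
open import Relation.Nullary using (¬_; yes; no)
open import Relation.Binary.PropositionalEquality
  using (_≡_; refl; sym; trans; cong; cong₂; subst; subst₂; setoid; module ≡-Reasoning)

Factor : {A : Set} → List A → List A → Set
Factor v xs = ∃₂ λ u w → u ++ v ++ w ≡ xs

module _ {A : Set} where

  factor-refl : (xs : List A) → Factor xs xs
  factor-refl xs = [] , [] , ++-identityʳ xs

  factor-++ˡ : ∀ {v ys} (xs : List A) → Factor v ys → Factor v (xs ++ ys)
  factor-++ˡ xs (u , w , refl) = xs ++ u , w , ++-assoc xs u _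

  factor-++ʳ : ∀ {v xs} (ys : List A) → Factor v xs → Factor v (xs ++ ys)
  factor-++ʳ {v} ys (u , w , refl) = u , w ++ ys , (begin
    u ++ v ++ w ++ ys     ≡⟨ cong (u ++_) (++-assoc v w ys) ⟨
    u ++ (v ++ w) ++ ys   ≡⟨ ++-assoc u (v ++ w) ys ⟨
    (u ++ v ++ w) ++ ys   ∎)
    where open ≡-Reasoning

  factor-trans : ∀ {v ys xs : List A} → Factor v ys → Factor ys xs → Factor v xs
  factor-trans p (u , w , refl) = factor-++ˡ u (factor-++ʳ w p)

  factor-∈ : ∀ {v xs : List A} {z} → Factor v xs → z ∈ v → z ∈ xs
  factor-∈ (u , w , refl) z∈v = ∈-++⁺ʳ u (∈-++⁺ˡ z∈v)

  factor-prefix : (xs ys : List A) → Factor xs (xs ++ ys)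
  factor-prefix xs ys = [] , ys , refl

  factor-suffix : (xs ys : List A) → Factor ys (xs ++ ys)
  factor-suffix xs ys = factor-++ˡ xs (factor-refl ys)

  factor-reverse⁺ : ∀ {v xs : List A} → Factor v xs → Factor (reverse v) (reverse xs)
  factor-reverse⁺ {v} (u , w , refl) = reverse w , reverse u , (begin
    reverse w ++ reverse v ++ reverse u    ≡⟨ ++-assoc (reverse w) (reverse v) (reverse u) ⟨
    (reverse w ++ reverse v) ++ reverse u  ≡⟨ cong (_++ reverse u) (reverse-++ v w) ⟨
    reverse (v ++ w) ++ reverse u          ≡⟨ reverse-++ u (v ++ w) ⟨
    reverse (u ++ v ++ w)                  ∎)
    where open ≡-Reasoning

  private
    prefix-split : ∀ v {w} α {m : A} {β} → v ++ w ≡ α ++ m ∷ β → (∃ λ w′ → v ++ w′ ≡ α) ⊎ m ∈ v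
    prefix-split []      α       e = inj₁ (α , refl)
    prefix-split (x ∷ v) []      e = inj₂ (here (sym (∷-injectiveˡ e)))
    prefix-split (x ∷ v) (y ∷ α) e with refl , e′ ← ∷-injective e =
      Sum.map (λ (w′ , p) → w′ , cong (x ∷_) p) there (prefix-split v α e′)

  factor-split : ∀ {v} α m β → Factor v (α ++ m ∷ β) → Factor v α ⊎ Factor v β ⊎ m ∈ v
  factor-split {v} α m β ([] , w , e) =
    Sum.map (λ (w′ , p) → [] , w′ , p) inj₂ (prefix-split v α e)
  factor-split []      m β (x ∷ u , w , e) = inj₂ (inj₁ (u , w , ∷-injectiveʳ e))
  factor-split (a ∷ α) m β (x ∷ u , w , e) with refl , e′ ← ∷-injective e =
    Sum.map₁ (factor-++ˡ [ a ]) (factor-split α m β (u , w , e′))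

module _ {A B : Set} (f : A → B) where

  factor-map⁺ : ∀ {v xs} → Factor v xs → Factor (map f v) (map f xs)
  factor-map⁺ {v} (u , w , refl) = map f u , map f w , (begin
    map f u ++ map f v ++ map f w   ≡⟨ cong (map f u ++_) (map-++ f v w) ⟨
    map f u ++ map f (v ++ w)       ≡⟨ map-++ f u (v ++ w) ⟨
    map f (u ++ v ++ w)             ∎)
    where open ≡-Reasoning

  private
    map-≡-++ : ∀ xs {ys zs} → map f xs ≡ ys ++ zs →
               ∃₂ λ as bs → xs ≡ as ++ bs × map f as ≡ ys × map f bs ≡ zs
    map-≡-++ xs       {[]}     e = [] , xs , refl , refl , e
    map-≡-++ (x ∷ xs) {y ∷ ys} e with refl , e′ ← ∷-injective e
      with as , bs , refl , refl , refl ← map-≡-++ xs {ys} e′ = x ∷ as , bs , refl , refl , refl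

  factor-map⁻ : ∀ {v} xs → Factor v (map f xs) → ∃ λ v₀ → Factor v₀ xs × map f v₀ ≡ v
  factor-map⁻ {v} xs (u , w , e)
    with as , bs , refl , _ , e′ ← map-≡-++ xs {u} (sym e)
    with cs , ds , refl , refl , _ ← map-≡-++ bs {v} e′ = cs , (as , ds , refl) , refl

xs≤maxL : ∀ xs → All (_≤ maxL xs) xs
xs≤maxL []       = []
xs≤maxL (x ∷ xs) = m≤m⊔n x (maxL xs) ∷ All.map (λ p → ≤-trans p (m≤n⊔m x (maxL xs))) (xs≤maxL xs)

maxL≤ : ∀ {y ys} → All (_≤ y) ys → maxL ys ≤ y
maxL≤ []       = z≤n
maxL≤ (p ∷ ps) = ⊔-lub p (maxL≤ ps)

private
  maxL∈-∷ : ∀ x xs → maxL (x ∷ xs) ∈ x ∷ xs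
  maxL∈-∷ x []       = here (⊔-identityʳ x)
  maxL∈-∷ x (y ∷ xs) with ⊔-sel x (maxL (y ∷ xs))
  ... | inj₁ eq = here eq
  ... | inj₂ eq = subst (_∈ x ∷ y ∷ xs) (sym eq) (there (maxL∈-∷ y xs))

maxL∈ : ∀ {z xs} → z ∈ xs → maxL xs ∈ xs
maxL∈ {xs = x ∷ xs} _ = maxL∈-∷ x xs

maxL≡ : ∀ {y ys} → y ∈ ys → All (_≤ y) ys → maxL ys ≡ y
maxL≡ {ys = ys} y∈ys bound = ≤-antisym (maxL≤ bound) (All.lookup (xs≤maxL ys) y∈ys)

splitOn-++ : ∀ m xs → m ∈ xs → xs ≡ proj₁ (splitOn m xs) ++ m ∷ proj₂ (splitOn m xs)
splitOn-++ m (x ∷ xs) m∈ with x ≟ m | m∈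
... | yes refl | _          = refl
... | no  x≢m  | here refl  = ⊥-elim (x≢m refl)
... | no  x≢m  | there m∈xs = cong (x ∷_) (splitOn-++ m xs m∈xs)

splitOn-∉ : ∀ m xs → m ∉ proj₁ (splitOn m xs)
splitOn-∉ m (x ∷ xs) m∈ with x ≟ m | m∈
... | no x≢m | here refl  = x≢m refl
... | no x≢m | there m∈xs = splitOn-∉ m xs m∈xs

splitOn-map : ∀ (f : ℕ → ℕ) m xs → (∀ {z} → z ∈ xs → f z ≡ f m → z ≡ m) →
  splitOn (f m) (map f xs) ≡ (map f (proj₁ (splitOn m xs)) , map f (proj₂ (splitOn m xs)))
splitOn-map f m []       inj = refl
splitOn-map f m (x ∷ xs) inj with x ≟ m | f x ≟ f m
... | yes refl | yes _     = refl
... | yes refl | no  fx≢fx = ⊥-elim (fx≢fx refl)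
... | no  x≢m  | yes fx≡fm = ⊥-elim (x≢m (inj (here refl) fx≡fm))
... | no  x≢m  | no  _     rewrite splitOn-map f m xs (inj ∘ there) = refl

Dominates : {A : Set} → (A → ℕ) → List A → A → A → Set
Dominates key xs x y = ∃ λ v → Factor v xs × x ∈ v × y ∈ v × All (λ z → key z ≤ key x) v

DominanceMonotone : {A : Set} → (A → ℕ) → (A → ℕ) → List A → Set
DominanceMonotone key f xs = ∀ {x y} → Dominates key xs x y → f y ≤ f x

InjectiveOn : {A B : Set} → (A → B) → List A → Set
InjectiveOn f xs = ∀ {a b} → a ∈ xs → b ∈ xs → f a ≡ f b → a ≡ b

injectiveOn-⊆ : {A B : Set} {f : A → B} {xs ys : List A} →
  (∀ {z} → z ∈ ys → z ∈ xs) → InjectiveOn f xs → InjectiveOn f ys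
injectiveOn-⊆ ys⊆xs f-inj a∈ b∈ = f-inj (ys⊆xs a∈) (ys⊆xs b∈)

module _ {A : Set} {key : A → ℕ} where

  dominates-≤ : ∀ {xs x y} → Dominates key xs x y → key y ≤ key x
  dominates-≤ (_ , _ , _ , y∈v , bound) = All.lookup bound y∈v

  dominates-∈ˡ : ∀ {xs x y} → Dominates key xs x y → x ∈ xs
  dominates-∈ˡ (_ , v⊑xs , x∈v , _) = factor-∈ v⊑xs x∈v

  dominates-∈ʳ : ∀ {xs x y} → Dominates key xs x y → y ∈ xs
  dominates-∈ʳ (_ , v⊑xs , _ , y∈v , _) = factor-∈ v⊑xs y∈v

  dominates-factor : ∀ {w xs x y} → Factor w xs → Dominates key w x y → Dominates key xs x y
  dominates-factor w⊑xs (v , v⊑w , r) = v , factor-trans v⊑w w⊑xs , r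

  dominanceMonotone-factor : ∀ {f w xs} → Factor w xs →
    DominanceMonotone key f xs → DominanceMonotone key f w
  dominanceMonotone-factor w⊑xs mono d = mono (dominates-factor w⊑xs d)

  dominates-reverse : ∀ {xs x y} → Dominates key xs x y → Dominates key (reverse xs) x y
  dominates-reverse (v , v⊑xs , x∈v , y∈v , bound) =
    reverse v , factor-reverse⁺ v⊑xs , ∈-resp-rev x∈v , ∈-resp-rev y∈v ,
    ↭.All-resp-↭ (↭-sym (↭.↭-reverse v)) bound
    where
      ∈-resp-rev : ∀ {z} → z ∈ v → z ∈ reverse v
      ∈-resp-rev = ↭.∈-resp-↭ (↭-sym (↭.↭-reverse v))

  dominanceMonotone-[] : ∀ {f} → DominanceMonotone key f []
  dominanceMonotone-[] (_ , v⊑ , x∈v , _) with () ← factor-∈ v⊑ x∈v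

  dominates-split : ∀ α m β {x y} → Dominates key (α ++ m ∷ β) x y →
    Dominates key α x y ⊎ Dominates key β x y ⊎ key m ≤ key x
  dominates-split α m β (v , v⊑ , r@(_ , _ , bound)) with factor-split α m β v⊑
  ... | inj₁ v⊑α        = inj₁ (v , v⊑α , r)
  ... | inj₂ (inj₁ v⊑β) = inj₂ (inj₁ (v , v⊑β , r))
  ... | inj₂ (inj₂ m∈v) = inj₂ (inj₂ (All.lookup bound m∈v))

  dominates-rekey : ∀ {g : ℕ → ℕ} → (∀ {a b} → a ≤ b → g a ≤ g b) →
    ∀ {xs x y} → Dominates key xs x y → Dominates (g ∘ key) xs x y
  dominates-rekey g-mono (v , r , x∈v , y∈v , bound) = v , r , x∈v , y∈v , All.map g-mono bound

  dominanceMonotone-++-∷ : ∀ {f} as z bs →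
    DominanceMonotone key f as → DominanceMonotone key f bs →
    All (λ p → key p < key z) as → All (λ p → key p < key z) bs →
    All (λ q → f q ≤ f z) (as ++ z ∷ bs) → DominanceMonotone key f (as ++ z ∷ bs)
  dominanceMonotone-++-∷ as z bs mono-as mono-bs as<z bs<z ≤fz d with dominates-split as z bs d
  ... | inj₁ d-as        = mono-as d-as
  ... | inj₂ (inj₁ d-bs) = mono-bs d-bs
  ... | inj₂ (inj₂ z≤x)  with ∈-++⁻ as (dominates-∈ˡ d)
  ...   | inj₁ x∈as         = ⊥-elim (<⇒≱ (All.lookup as<z x∈as) z≤x)
  ...   | inj₂ (there x∈bs) = ⊥-elim (<⇒≱ (All.lookup bs<z x∈bs) z≤x)
  ...   | inj₂ (here refl)  = All.lookup ≤fz (dominates-∈ʳ d)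

module _ {A B : Set} {key : B → ℕ} (h : A → B) where

  dominates-map⁺ : ∀ {xs x y} → Dominates (key ∘ h) xs x y → Dominates key (map h xs) (h x) (h y)
  dominates-map⁺ (v , v⊑xs , x∈v , y∈v , bound) =
    map h v , factor-map⁺ h v⊑xs , ∈-map⁺ h x∈v , ∈-map⁺ h y∈v , All.map⁺ bound

  dominates-map⁻ : ∀ xs {x y} → Dominates key (map h xs) x y →
    ∃₂ λ x₀ y₀ → x ≡ h x₀ × y ≡ h y₀ × Dominates (key ∘ h) xs x₀ y₀
  dominates-map⁻ xs (v , v⊑ , x∈v , y∈v , bound) with v₀ , v₀⊑xs , refl ← factor-map⁻ h xs v⊑
    with x₀ , x₀∈v₀ , refl ← ∈-map⁻ h x∈v | y₀ , y₀∈v₀ , refl ← ∈-map⁻ h y∈v =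
    x₀ , y₀ , refl , refl , v₀ , v₀⊑xs , x₀∈v₀ , y₀∈v₀ , All.map⁻ bound

module _ {f : ℕ → ℕ} {xs : List ℕ}
         (f-inj : InjectiveOn f xs) (f-mono : DominanceMonotone id f xs) where

  dominates-reflect : ∀ {x y} → Dominates f xs x y → Dominates id xs x y
  dominates-reflect {x} (v , v⊑ , x∈v , y∈v , bound) =
    v , v⊑ , x∈v , y∈v , subst (λ t → All (_≤ t) v) (sym x≡max) (xs≤maxL v)
    where
      max∈v : maxL v ∈ v
      max∈v = maxL∈ x∈v
      x≡max : x ≡ maxL v
      x≡max = f-inj (factor-∈ v⊑ x∈v) (factor-∈ v⊑ max∈v)
                (≤-antisym (f-mono (v , v⊑ , max∈v , x∈v , xs≤maxL v)) (All.lookup bound max∈v))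

  dominanceMonotone-inverse : ∀ {g} → (∀ {z} → z ∈ xs → g (f z) ≡ z) →
    DominanceMonotone id g (map f xs)
  dominanceMonotone-inverse g∘f d with _ , _ , refl , refl , d₀ ← dominates-map⁻ f xs d =
    subst₂ _≤_ (sym (g∘f (dominates-∈ʳ d₀))) (sym (g∘f (dominates-∈ˡ d₀)))
      (dominates-≤ (dominates-reflect d₀))

module MaxSplit (x : ℕ) (xs : List ℕ) where

  τ : List ℕ
  τ = x ∷ xs

  m : ℕ
  m = maxL τ

  α β : List ℕ
  α = proj₁ (splitOn m τ)
  β = proj₂ (splitOn m τ)

  m∈τ : m ∈ τ
  m∈τ = maxL∈ (here refl)

  τ≡α++m∷β : τ ≡ α ++ m ∷ β
  τ≡α++m∷β = splitOn-++ m τ m∈τ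

  factor-α : Factor α τ
  factor-α = subst (Factor α) (sym τ≡α++m∷β) (factor-prefix α (m ∷ β))

  factor-β : Factor β τ
  factor-β = subst (Factor β) (sym τ≡α++m∷β) (factor-++ˡ α (factor-suffix [ m ] β))

  length-τ : length τ ≡ length α + suc (length β)
  length-τ = trans (cong length τ≡α++m∷β) (length-++ α)

  max-dominates : ∀ {z} → z ∈ τ → Dominates id τ m z
  max-dominates z∈τ = τ , factor-refl τ , m∈τ , z∈τ , xs≤maxL τ

stackFuel-↭ : ∀ k xs → stackFuel k xs ↭ xs
stackFuel-↭ zero    xs       = ↭-refl
stackFuel-↭ (suc k) []       = ↭-refl
stackFuel-↭ (suc k) (x ∷ xs) = begin
    stackFuel k α ++ stackFuel k β ++ [ m ]
      ↭⟨ ↭.++⁺ (stackFuel-↭ k α) (↭.++⁺ʳ [ m ] (stackFuel-↭ k β)) ⟩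
    α ++ β ++ [ m ]  ↭⟨ ↭.++⁺ˡ α (↭.++-comm β [ m ]) ⟩
    α ++ m ∷ β       ≡⟨ τ≡α++m∷β ⟨
    τ                ∎
  where
    open MaxSplit x xs
    open PermutationReasoning

bound-dominates : ∀ {L τ x y} → L ↭ τ → x ∈ τ → y ∈ τ → All (_≤ x) τ → Dominates id L x y
bound-dominates {L} L↭τ x∈τ y∈τ bound =
  L , factor-refl L , ↭.∈-resp-↭ (↭-sym L↭τ) x∈τ , ↭.∈-resp-↭ (↭-sym L↭τ) y∈τ ,
  ↭.All-resp-↭ (↭-sym L↭τ) bound

dominates-stackFuel : ∀ k {τ x y} → Dominates id τ x y → Dominates id (stackFuel k τ) x y
dominates-stackFuel zero               d = d
dominates-stackFuel (suc k) {[]}       d = d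
dominates-stackFuel (suc k) {x₀ ∷ xs} {x} {y} d@(v , v⊑τ , x∈v , y∈v , _) =
  Sum.[ dominates-factor (factor-prefix _ _) ∘ dominates-stackFuel k
      , Sum.[ dominates-factor (factor-++ˡ (stackFuel k α) (factor-prefix _ _))
              ∘ dominates-stackFuel k
            , whole ] ]
    (dominates-split α m β (subst (λ l → Dominates id l x y) τ≡α++m∷β d))
  where
    open MaxSplit x₀ xs
    whole : m ≤ x → Dominates id (stackFuel (suc k) τ) x y
    whole m≤x = bound-dominates (stackFuel-↭ (suc k) τ) (factor-∈ v⊑τ x∈v) (factor-∈ v⊑τ y∈v)
                  (All.map (λ z≤m → ≤-trans z≤m m≤x) (xs≤maxL τ))

runOp-↭ : ∀ o τ → runOp o τ ↭ τ
runOp-↭ opS τ = stackFuel-↭ (length τ) τ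
runOp-↭ opR τ = ↭.↭-reverse τ

run-↭ : ∀ os θ → run os θ ↭ θ
run-↭ []       θ = ↭-refl
run-↭ (o ∷ os) θ = ↭-trans (runOp-↭ o (run os θ)) (run-↭ os θ)

dominates-runOp : ∀ o {τ x y} → Dominates id τ x y → Dominates id (runOp o τ) x y
dominates-runOp opS {τ} = dominates-stackFuel (length τ)
dominates-runOp opR     = dominates-reverse

dominates-run : ∀ os {θ x y} → Dominates id θ x y → Dominates id (run os θ) x y
dominates-run []       = id
dominates-run (o ∷ os) = dominates-runOp o ∘ dominates-run os

private
  sortAround : ℕ → ℕ → List ℕ × List ℕ → List ℕ
  sortAround k c (l , r) = stackFuel k l ++ stackFuel k r ++ [ c ]

stackFuel-map : ∀ k {f} τ → InjectiveOn f τ → DominanceMonotone id f τ →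
  stackFuel k (map f τ) ≡ map f (stackFuel k τ)
stackFuel-map zero        τ        _     _      = refl
stackFuel-map (suc k)     []       _     _      = refl
stackFuel-map (suc k) {f} (x ∷ xs) f-inj f-mono = begin
    sortAround k (maxL (map f τ)) (splitOn (maxL (map f τ)) (map f τ))
  ≡⟨ cong (λ c → sortAround k c (splitOn c (map f τ))) maxL-map ⟩
    sortAround k (f m) (splitOn (f m) (map f τ))
  ≡⟨ cong (sortAround k (f m)) (splitOn-map f m τ (λ z∈τ → f-inj z∈τ m∈τ)) ⟩
    stackFuel k (map f α) ++ stackFuel k (map f β) ++ [ f m ]
  ≡⟨ cong₂ (λ a b → a ++ b ++ [ f m ]) (on-factor α factor-α) (on-factor β factor-β) ⟩
    map f (stackFuel k α) ++ map f (stackFuel k β) ++ [ f m ]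
  ≡⟨ cong (map f (stackFuel k α) ++_) (map-++ f (stackFuel k β) [ m ]) ⟨
    map f (stackFuel k α) ++ map f (stackFuel k β ++ [ m ])
  ≡⟨ map-++ f (stackFuel k α) _ ⟨
    map f (stackFuel k α ++ stackFuel k β ++ [ m ])
  ∎
  where
    open MaxSplit x xs
    open ≡-Reasoning
    maxL-map : maxL (map f τ) ≡ f m
    maxL-map = maxL≡ (∈-map⁺ f m∈τ) (All.map⁺ (All.tabulate (f-mono ∘ max-dominates)))
    on-factor : ∀ w → Factor w τ → stackFuel k (map f w) ≡ map f (stackFuel k w)
    on-factor w w⊑τ = stackFuel-map k w (injectiveOn-⊆ (factor-∈ w⊑τ) f-inj)
                                          (dominanceMonotone-factor w⊑τ f-mono)

runOp-map : ∀ o {f} τ → InjectiveOn f τ → DominanceMonotone id f (runOp o τ) →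
  runOp o (map f τ) ≡ map f (runOp o τ)
runOp-map opS {f} τ f-inj f-mono =
  trans (cong (λ k → stackFuel k (map f τ)) (length-map f τ))
        (stackFuel-map (length τ) τ f-inj (f-mono ∘ dominates-stackFuel (length τ)))
runOp-map opR {f} τ _ _ = sym (reverse-map f τ)

run-map : ∀ os {f} θ → InjectiveOn f θ → DominanceMonotone id f (run os θ) →
  run os (map f θ) ≡ map f (run os θ)
run-map []            θ _     _      = refl
run-map (o ∷ os) {f} θ f-inj f-mono = begin
    runOp o (run os (map f θ))
      ≡⟨ cong (runOp o) (run-map os θ f-inj (f-mono ∘ dominates-runOp o)) ⟩
    runOp o (map f (run os θ))
      ≡⟨ runOp-map o (run os θ) (injectiveOn-⊆ (↭.∈-resp-↭ (run-↭ os θ)) f-inj) f-mono ⟩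
    map f (runOp o (run os θ))
      ∎
  where open ≡-Reasoning

module _ {A : Set} where

  unique-++⁻ : ∀ xs {ys : List A} → Unique (xs ++ ys) → Unique xs × Unique ys
  unique-++⁻ []       u          = [] , u
  unique-++⁻ (x ∷ xs) (x∉ ∷ u) with uxs , uys ← unique-++⁻ xs u = All.++⁻ˡ xs x∉ ∷ uxs , uys

  unique-map⁺ : ∀ {B : Set} {f : A → B} {xs} → InjectiveOn f xs → Unique xs → Unique (map f xs)
  unique-map⁺                 f-inj []         = []
  unique-map⁺ {f = f} {x ∷ xs} f-inj (x≢ ∷ u) =
    All.map⁺ (All.tabulate (λ y∈ fx≡fy → All.lookup x≢ y∈ (f-inj (here refl) (there y∈) fx≡fy)))
    ∷ unique-map⁺ (injectiveOn-⊆ there f-inj) u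

rank-mono : ∀ {xs ys a b} → xs ⊆ ys → a ≤ b → rank xs a ≤ rank ys b
rank-mono xs⊆ys a≤b =
  s≤s (length-mono-≤ (filter⁺ (_<? _) (_<? _) (λ { refl z<a → <-≤-trans z<a a≤b }) xs⊆ys))

rank-∷-< : ∀ {z a} xs → z < a → rank (z ∷ xs) a ≡ suc (rank xs a)
rank-∷-< {a = a} xs z<a = cong (suc ∘ length) (filter-accept (_<? a) z<a)

rank-∷-≮ : ∀ {z a} xs → ¬ z < a → rank (z ∷ xs) a ≡ rank xs a
rank-∷-≮ {a = a} xs z≮a = cong (suc ∘ length) (filter-reject (_<? a) z≮a)

rank-< : ∀ {a b} xs → a ∈ xs → a < b → rank xs a < rank xs b
rank-< {a} {b} (z ∷ xs) (here refl) a<b = begin-strict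
  rank (a ∷ xs) a   ≡⟨ rank-∷-≮ xs (<-irrefl refl) ⟩
  rank xs a         ≤⟨ rank-mono {xs} ⊆-refl (<⇒≤ a<b) ⟩
  rank xs b         <⟨ n<1+n _ ⟩
  suc (rank xs b)   ≡⟨ rank-∷-< xs a<b ⟨
  rank (a ∷ xs) b   ∎
  where open ≤-Reasoning
rank-< {a} {b} (z ∷ xs) (there a∈xs) a<b with z <? a
... | yes z<a = begin-strict
  rank (z ∷ xs) a   ≡⟨ rank-∷-< xs z<a ⟩
  suc (rank xs a)   <⟨ s≤s (rank-< xs a∈xs a<b) ⟩
  suc (rank xs b)   ≡⟨ rank-∷-< xs (<-trans z<a a<b) ⟨
  rank (z ∷ xs) b   ∎
  where open ≤-Reasoning
... | no z≮a = begin-strict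
  rank (z ∷ xs) a   ≡⟨ rank-∷-≮ xs z≮a ⟩
  rank xs a         <⟨ rank-< xs a∈xs a<b ⟩
  rank xs b         ≤⟨ rank-mono {xs} (z ∷ʳ ⊆-refl) ≤-refl ⟩
  rank (z ∷ xs) b   ∎
  where open ≤-Reasoning

rank-injectiveOn : ∀ xs → InjectiveOn (rank xs) xs
rank-injectiveOn xs {a} {b} a∈ b∈ ra≡rb with <-cmp a b
... | tri< a<b _ _ = ⊥-elim (<-irrefl ra≡rb (rank-< xs a∈ a<b))
... | tri≈ _ a≡b _ = a≡b
... | tri> _ _ b<a = ⊥-elim (<-irrefl (sym ra≡rb) (rank-< xs b∈ b<a))

unique-std : ∀ {xs} → Unique xs → Unique (std xs)
unique-std {xs} = unique-map⁺ (rank-injectiveOn xs)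

module _ {A B : Set} where

  zip-++ : ∀ (as : List A) (bs : List B) {as′ bs′} → length as ≡ length bs →
    zip (as ++ as′) (bs ++ bs′) ≡ zip as bs ++ zip as′ bs′
  zip-++ []       []       _  = refl
  zip-++ (a ∷ as) (b ∷ bs) eq = cong ((a , b) ∷_) (zip-++ as bs (suc-injective eq))

  All-zipˡ : ∀ {P : A → Set} {xs} {ys : List B} → All P xs → All (P ∘ proj₁) (zip xs ys)
  All-zipˡ                []       = []
  All-zipˡ {ys = []}      (_ ∷ _)  = []
  All-zipˡ {ys = _ ∷ _}   (p ∷ ps) = p ∷ All-zipˡ ps

  All-zipʳ : ∀ {P : B → Set} {xs : List A} {ys} → All P ys → All (P ∘ proj₂) (zip xs ys)
  All-zipʳ {xs = []}    _        = []
  All-zipʳ {xs = _ ∷ _} []       = []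
  All-zipʳ {xs = _ ∷ _} (p ∷ ps) = p ∷ All-zipʳ ps

module _ {A B C : Set} where

  zip-mapˡ : ∀ (g : A → C) xs (ys : List B) → zip (map g xs) ys ≡ map (Product.map g id) (zip xs ys)
  zip-mapˡ g xs ys = trans (cong (zip (map g xs)) (sym (map-id ys))) (zip-map g id xs ys)

  zip-mapʳ : ∀ (g : B → C) (xs : List A) ys → zip xs (map g ys) ≡ map (Product.map id g) (zip xs ys)
  zip-mapʳ g xs ys = trans (cong (λ l → zip l (map g ys)) (sym (map-id xs))) (zip-map id g xs ys)

zip-map-self : ∀ (f : ℕ → ℕ) xs → zip xs (map f xs) ≡ map < id , f > xs
zip-map-self f []       = refl
zip-map-self f (x ∷ xs) = cong ((x , f x) ∷_) (zip-map-self f xs)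

DominanceAligned : List ℕ → List ℕ → Set
DominanceAligned xs ys = DominanceMonotone proj₁ proj₂ (zip xs ys)

module _ {g : ℕ → ℕ} (g-mono : ∀ {a b} → a ≤ b → g a ≤ g b) where

  dominanceAligned-mapˡ : ∀ xs ys → DominanceAligned (map g xs) ys → DominanceAligned xs ys
  dominanceAligned-mapˡ xs ys aligned d =
    aligned (subst (λ l → Dominates proj₁ l _ _) (sym (zip-mapˡ g xs ys))
              (dominates-map⁺ (Product.map g id) (dominates-rekey g-mono d)))

  dominanceAligned-mapʳ : ∀ xs ys → DominanceAligned xs ys → DominanceAligned xs (map g ys)
  dominanceAligned-mapʳ xs ys aligned d
    with _ , _ , refl , refl , d₀ ← dominates-map⁻ (Product.map id g) (zip xs ys)
                                      (subst (λ l → Dominates proj₁ l _ _) (zip-mapʳ g xs ys) d)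
    = g-mono (aligned d₀)

dominanceAligned⇒dominanceMonotone : ∀ {f} xs → DominanceAligned xs (map f xs) →
  DominanceMonotone id f xs
dominanceAligned⇒dominanceMonotone {f} xs aligned d =
  aligned (subst (λ l → Dominates proj₁ l _ _) (sym (zip-map-self f xs))
            (dominates-map⁺ < id , f > d))

module PSplit (k x : ℕ) (xs : List ℕ) where
  open MaxSplit x xs public

  A B : List ℕ
  A = PFuel k (std α)
  B = PFuel k (std β)

  c : ℕ
  c = suc (length A) + length B

  shift : ℕ → ℕ
  shift = _+ length B

  P-τ : PFuel (suc k) τ ≡ map shift A ++ c ∷ B
  P-τ = trans (cong (_++ B) (map-++ shift A [ suc (length A) ])) (++-assoc (map shift A) [ c ] B)

  length-P-τ : length (map shift A ++ c ∷ B) ≡ c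
  length-P-τ = begin
    length (map shift A ++ c ∷ B)       ≡⟨ length-++ (map shift A) ⟩
    length (map shift A) + suc (length B) ≡⟨ cong (_+ suc (length B)) (length-map shift A) ⟩
    length A + suc (length B)           ≡⟨ +-suc (length A) (length B) ⟩
    c                                   ∎
    where open ≡-Reasoning

  P-τ-bounded : All (_≤ length A) A → All (_≤ length B) B → All (_≤ c) (map shift A ++ c ∷ B)
  P-τ-bounded A≤ B≤ =
    All.++⁺ (All.map⁺ (All.map (λ a≤ → ≤-trans (+-monoˡ-≤ (length B) a≤) (n≤1+n _)) A≤))
            (≤-refl ∷ All.map (λ b≤ → ≤-trans b≤ (m≤n+m (length B) (suc (length A)))) B≤)

  module _ (fuel : length τ ≤ suc k) where

    private
      |α|+|β|≤k : length α + length β ≤ k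
      |α|+|β|≤k = ≤-pred (begin
        suc (length α + length β)  ≡⟨ +-suc (length α) (length β) ⟨
        length α + suc (length β)  ≡⟨ length-τ ⟨
        length τ                   ≤⟨ fuel ⟩
        suc k                      ∎)
        where open ≤-Reasoning

    fuel-α : length (std α) ≤ k
    fuel-α = ≤-trans (≤-reflexive (length-map (rank α) α)) (m+n≤o⇒m≤o (length α) |α|+|β|≤k)

    fuel-β : length (std β) ≤ k
    fuel-β = ≤-trans (≤-reflexive (length-map (rank β) β)) (m+n≤o⇒n≤o (length α) |α|+|β|≤k)

P-length : ∀ k xs → length xs ≤ k → length (PFuel k xs) ≡ length xs
P-length zero    []       _    = refl
P-length (suc k) []       _    = refl
P-length (suc k) (x ∷ xs) fuel = begin
    length (PFuel (suc k) τ)        ≡⟨ cong length P-τ ⟩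
    length (map shift A ++ c ∷ B)   ≡⟨ length-P-τ ⟩
    suc (length A + length B)
      ≡⟨ cong₂ (λ a b → suc (a + b)) (length-part α (fuel-α fuel)) (length-part β (fuel-β fuel)) ⟩
    suc (length α + length β)       ≡⟨ +-suc (length α) (length β) ⟨
    length α + suc (length β)       ≡⟨ length-τ ⟨
    length τ                        ∎
  where
    open PSplit k x xs
    open ≡-Reasoning
    length-part : ∀ w → length (std w) ≤ k → length (PFuel k (std w)) ≡ length w
    length-part w w-fuel = trans (P-length k (std w) w-fuel) (length-map (rank w) w)

P-bounded : ∀ k xs → length xs ≤ k → All (_≤ length (PFuel k xs)) (PFuel k xs)
P-bounded zero    []       _    = []
P-bounded (suc k) []       _    = []
P-bounded (suc k) (x ∷ xs) fuel =
  subst (λ l → All (_≤ length l) l) (sym P-τ)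
    (subst (λ n → All (_≤ n) (map shift A ++ c ∷ B)) (sym length-P-τ)
      (P-τ-bounded (P-bounded k (std α) (fuel-α fuel)) (P-bounded k (std β) (fuel-β fuel))))
  where open PSplit k x xs

P-dominanceAligned : ∀ k xs → length xs ≤ k → Unique xs → DominanceAligned xs (PFuel k xs)
P-dominanceAligned zero    []       _    _ = dominanceMonotone-[]
P-dominanceAligned (suc k) []       _    _ = dominanceMonotone-[]
P-dominanceAligned (suc k) (x ∷ xs) fuel u =
  subst (DominanceMonotone proj₁ proj₂) (sym zip-τ)
    (dominanceMonotone-++-∷ (zip α (map shift A)) (m , c) (zip β B)
      (dominanceAligned-mapʳ (+-monoˡ-≤ (length B)) α A (aligned-part α unique-α (fuel-α fuel)))
      (aligned-part β unique-β (fuel-β fuel))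
      (All-zipˡ α<m) (All-zipˡ β<m) bound)
  where
    open PSplit k x xs
    unique-α : Unique α
    unique-α = proj₁ (unique-++⁻ α (subst Unique τ≡α++m∷β u))
    unique-m∷β : Unique (m ∷ β)
    unique-m∷β = proj₂ (unique-++⁻ α (subst Unique τ≡α++m∷β u))
    unique-β : Unique β
    unique-β = AllPairs.tail unique-m∷β
    α<m : All (_< m) α
    α<m = All.tabulate λ z∈α → ≤∧≢⇒< (All.lookup (xs≤maxL τ) (factor-∈ factor-α z∈α))
                                     (λ { refl → splitOn-∉ m τ z∈α })
    β<m : All (_< m) β
    β<m = All.tabulate λ z∈β → ≤∧≢⇒< (All.lookup (xs≤maxL τ) (factor-∈ factor-β z∈β))
                                     (λ { refl → Unique[x∷xs]⇒x∉xs unique-m∷β z∈β })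
    aligned-part : ∀ w → Unique w → length (std w) ≤ k → DominanceAligned w (PFuel k (std w))
    aligned-part w unique-w w-fuel =
      dominanceAligned-mapˡ (rank-mono {w} ⊆-refl) w _
        (P-dominanceAligned k (std w) w-fuel (unique-std unique-w))
    |α|≡|shift-A| : length α ≡ length (map shift A)
    |α|≡|shift-A| = sym (trans (length-map shift A)
                          (trans (P-length k (std α) (fuel-α fuel)) (length-map (rank α) α)))
    zip-τ : zip τ (PFuel (suc k) τ) ≡ zip α (map shift A) ++ (m , c) ∷ zip β B
    zip-τ = trans (cong₂ zip τ≡α++m∷β P-τ) (zip-++ α (map shift A) |α|≡|shift-A|)
    bound : All (λ q → proj₂ q ≤ c) (zip α (map shift A) ++ (m , c) ∷ zip β B)
    bound = subst (All (λ q → proj₂ q ≤ c)) (zip-++ α (map shift A) |α|≡|shift-A|)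
              (All-zipʳ (P-τ-bounded (P-bounded k (std α) (fuel-α fuel))
                                     (P-bounded k (std β) (fuel-β fuel))))

P-dominanceMonotone : ∀ {f xs} → Unique xs → P xs ≡ map f xs → DominanceMonotone id f xs
P-dominanceMonotone {f} {xs} unique-xs P≡map =
  dominanceAligned⇒dominanceMonotone xs
    (subst (DominanceAligned xs) P≡map (P-dominanceAligned (length xs) xs ≤-refl unique-xs))

below-all : ∀ {p} T → Below p T → Decreasing T → All (_< p) (inorder T)
below-all leaf         _   _                     = []
below-all (node l x r) x<p (l<x , r<x , dl , dr) =
  All.++⁺ (All.map (λ z<x → <-trans z<x x<p) (below-all l l<x dl))
          (x<p ∷ All.map (λ z<x → <-trans z<x x<p) (below-all r r<x dr))

root-∈ : ∀ {x} l r → x ∈ inorder (node l x r)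
root-∈ l _ = ∈-++⁺ʳ (inorder l) (here refl)

root-dominates : ∀ {l x r y} → Decreasing (node l x r) → y ∈ inorder (node l x r) →
  Dominates id (inorder (node l x r)) x y
root-dominates {l} {x} {r} (l<x , r<x , dl , dr) y∈ =
  inorder (node l x r) , factor-refl _ , root-∈ l r , y∈ ,
  All.++⁺ (All.map <⇒≤ (below-all l l<x dl)) (≤-refl ∷ All.map <⇒≤ (below-all r r<x dr))

private
  ++-∷-cancel : ∀ {x} as bs cs ds → All (_< x) as → All (_< x) cs →
    as ++ x ∷ bs ≡ cs ++ x ∷ ds → as ≡ cs × bs ≡ ds
  ++-∷-cancel []       _  []       _  _          _          eq = refl , ∷-injectiveʳ eq
  ++-∷-cancel []       _  (c ∷ cs) _  _          (c<x ∷ _)  eq =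
    ⊥-elim (<-irrefl (sym (∷-injectiveˡ eq)) c<x)
  ++-∷-cancel (a ∷ as) _  []       _  (a<x ∷ _)  _          eq =
    ⊥-elim (<-irrefl (∷-injectiveˡ eq) a<x)
  ++-∷-cancel (a ∷ as) bs (c ∷ cs) ds (_ ∷ as<x) (_ ∷ cs<x) eq
    with refl , eq′ ← ∷-injective eq
    with refl , refl ← ++-∷-cancel as bs cs ds as<x cs<x eq′ = refl , refl

inorder-injective : ∀ {T T′} → Decreasing T → Decreasing T′ → inorder T ≡ inorder T′ → T ≡ T′
inorder-injective {leaf}       {leaf}          _ _ _ = refl
inorder-injective {leaf}       {node l′ _ _}   _ _ eq with () ← ++-conicalʳ (inorder l′) _ (sym eq)
inorder-injective {node l _ _} {leaf}          _ _ eq with () ← ++-conicalʳ (inorder l) _ eq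
inorder-injective {node l x r} {node l′ x′ r′} dT@(l<x , _ , dl , dr) dT′@(l′<x′ , _ , dl′ , dr′) eq
  with refl ← ≤-antisym (dominates-≤ (root-dominates dT′ (subst (x ∈_) eq (root-∈ l r))))
                         (dominates-≤ (root-dominates dT (subst (x′ ∈_) (sym eq) (root-∈ l′ r′))))
  with eqˡ , eqʳ ← ++-∷-cancel (inorder l) (inorder r) (inorder l′) (inorder r′)
                     (below-all l l<x dl) (below-all l′ l′<x′ dl′) eq
  = cong₂ (λ a b → node a x b) (inorder-injective dl dl′ eqˡ) (inorder-injective dr dr′ eqʳ)

inorder-relabel : ∀ λ′ T → inorder (relabel λ′ T) ≡ map (app λ′) (inorder T)
inorder-relabel λ′ leaf         = refl
inorder-relabel λ′ (node l x r) = begin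
  inorder (relabel λ′ l) ++ app λ′ x ∷ inorder (relabel λ′ r)
    ≡⟨ cong₂ (λ a b → a ++ app λ′ x ∷ b) (inorder-relabel λ′ l) (inorder-relabel λ′ r) ⟩
  map (app λ′) (inorder l) ++ map (app λ′) (x ∷ inorder r)
    ≡⟨ map-++ (app λ′) (inorder l) (x ∷ inorder r) ⟨
  map (app λ′) (inorder l ++ x ∷ inorder r) ∎
  where open ≡-Reasoning

relabel-decreasing : ∀ λ′ T → Decreasing T → InjectiveOn (app λ′) (inorder T) →
  DominanceMonotone id (app λ′) (inorder T) → Decreasing (relabel λ′ T)
relabel-decreasing λ′ leaf         _                     _     _      = tt
relabel-decreasing λ′ (node l x r) dT@(l<x , r<x , dl , dr) ν-inj ν-mono =
    below-relabel l l<x ∈-++⁺ˡ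
  , below-relabel r r<x (∈-++⁺ʳ (inorder l) ∘ there)
  , on-subtree l l⊑ dl
  , on-subtree r r⊑ dr
  where
    l⊑ : Factor (inorder l) (inorder (node l x r))
    l⊑ = factor-prefix (inorder l) (x ∷ inorder r)
    r⊑ : Factor (inorder r) (inorder (node l x r))
    r⊑ = factor-++ˡ (inorder l) (factor-suffix [ x ] (inorder r))
    on-subtree : ∀ t → Factor (inorder t) (inorder (node l x r)) → Decreasing t →
      Decreasing (relabel λ′ t)
    on-subtree t t⊑ dt =
      relabel-decreasing λ′ t dt (injectiveOn-⊆ (factor-∈ t⊑) ν-inj) (dominanceMonotone-factor t⊑ ν-mono)
    below-relabel : ∀ t → Below x t → (∀ {y} → y ∈ inorder t → y ∈ inorder (node l x r)) →
      Below (app λ′ x) (relabel λ′ t)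
    below-relabel leaf          _   _  = tt
    below-relabel (node tl y tr) y<x t⊆ =
      ≤∧≢⇒< (ν-mono (root-dominates dT y∈)) (λ νy≡νx → <-irrefl (ν-inj y∈ (root-∈ l r) νy≡νx) y<x)
      where
        y∈ : y ∈ inorder (node l x r)
        y∈ = t⊆ (root-∈ tl tr)

Tin-relabel : ∀ {λ′ θ T T′} → IsTin θ T → IsTin (λ′ ∘ₚ θ) T′ →
  InjectiveOn (app λ′) θ → DominanceMonotone id (app λ′) θ → T′ ≡ relabel λ′ T
Tin-relabel {λ′} {T = T} (dT , refl) (dT′ , inorder-T′) ν-inj ν-mono =
  inorder-injective dT′ (relabel-decreasing λ′ T dT ν-inj ν-mono)
    (trans inorder-T′ (sym (inorder-relabel λ′ T)))

position : ℕ → List ℕ → ℕ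
position v []       = 0
position v (x ∷ xs) with x ≟ v
... | yes _ = 1
... | no  _ = suc (position v xs)

position-< : ∀ {v xs} → v ∈ xs → ∃ λ j → position v xs ≡ suc j × j < length xs
position-< {v} {x ∷ xs} v∈ with x ≟ v | v∈
... | yes _   | _          = 0 , refl , s≤s z≤n
... | no  x≢v | here refl  = ⊥-elim (x≢v refl)
... | no  _   | there v∈xs with j , eq , j< ← position-< v∈xs = suc j , cong suc eq , s≤s j<

app-position : ∀ {v xs} → v ∈ xs → app xs (position v xs) ≡ v
app-position {v} {x ∷ xs} v∈ with x ≟ v | v∈
... | yes x≡v | _          = x≡v
... | no  x≢v | here refl  = ⊥-elim (x≢v refl)
... | no  _   | there v∈xs with position v xs | position-< v∈xs | app-position v∈xs
...   | _ | _ , refl , _ | app≡v = app≡v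

app-∈ : ∀ xs {j} → j < length xs → app xs (suc j) ∈ xs
app-∈ (x ∷ xs) {zero}  _        = here refl
app-∈ (x ∷ xs) {suc j} (s≤s j<) = there (app-∈ xs j<)

position-app : ∀ {xs j} → Unique xs → j < length xs → position (app xs (suc j)) xs ≡ suc j
position-app {x ∷ xs} {zero} _ _ with x ≟ x
... | yes _   = refl
... | no  x≢x = ⊥-elim (x≢x refl)
position-app {x ∷ xs} {suc j} (x∉ ∷ u) (s≤s j<) with x ≟ app xs (suc j)
... | yes x≡ = ⊥-elim (All.lookup x∉ (app-∈ xs j<) x≡)
... | no  _  = cong suc (position-app u j<)

map-app-[1…] : ∀ xs → map (app xs) (map suc (upTo (length xs))) ≡ xs
map-app-[1…] xs = begin
  map (app xs) (map suc (upTo (length xs)))  ≡⟨ map-∘ (upTo (length xs)) ⟨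
  map (app xs ∘ suc) (upTo (length xs))      ≡⟨ map-applyUpTo id (app xs ∘ suc) (length xs) ⟩
  applyUpTo (app xs ∘ suc) (length xs)       ≡⟨ applyUpTo-app xs ⟩
  xs                                         ∎
  where
    open ≡-Reasoning
    applyUpTo-app : ∀ xs → applyUpTo (app xs ∘ suc) (length xs) ≡ xs
    applyUpTo-app []       = refl
    applyUpTo-app (x ∷ xs) = cong (x ∷_) (applyUpTo-app xs)

∈-[1…]⁻ : ∀ {n z} → z ∈ map suc (upTo n) → ∃ λ j → z ≡ suc j × j < n
∈-[1…]⁻ z∈ with j , j∈ , refl ← ∈-map⁻ suc z∈ = j , refl , ∈-upTo⁻ j∈

unique-perm : ∀ {n θ} → IsPerm n θ → Unique θ
unique-perm {n} θ-perm =
  Setoid↭.Unique-resp-↭ (setoid ℕ) (↭⇒↭ₛ (↭-sym θ-perm)) (Unique.map⁺ suc-injective (upTo⁺ n))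

module PermutationOf {n λ′} (λ-perm : IsPerm n λ′) where

  ν μ : ℕ → ℕ
  ν = app λ′
  μ v = position v λ′

  private
    length-λ : length λ′ ≡ n
    length-λ = trans (↭.↭-length λ-perm) (trans (length-map suc (upTo n)) (length-upTo n))

    ∈λ : ∀ {v} → v ∈ map suc (upTo n) → v ∈ λ′
    ∈λ = ↭.∈-resp-↭ (↭-sym λ-perm)

  μ∘ν : ∀ {z} → z ∈ map suc (upTo n) → μ (ν z) ≡ z
  μ∘ν z∈ with j , refl , j<n ← ∈-[1…]⁻ z∈ =
    position-app (unique-perm λ-perm) (subst (j <_) (sym length-λ) j<n)

  ν∘μ : ∀ {v} → v ∈ map suc (upTo n) → ν (μ v) ≡ v
  ν∘μ v∈ = app-position (∈λ v∈)

  module _ {θ} (θ-perm : IsPerm n θ) where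

    private
      ∈I : ∀ {z} → z ∈ θ → z ∈ map suc (upTo n)
      ∈I = ↭.∈-resp-↭ θ-perm

    map-μ∘ν : map μ (map ν θ) ≡ θ
    map-μ∘ν = trans (sym (map-∘ θ)) (map-id-local (All.tabulate (μ∘ν ∘ ∈I)))

    map-ν∘μ : map ν (map μ θ) ≡ θ
    map-ν∘μ = trans (sym (map-∘ θ)) (map-id-local (All.tabulate (ν∘μ ∘ ∈I)))

    ν-injectiveOn : InjectiveOn ν θ
    ν-injectiveOn a∈ b∈ νa≡νb = trans (sym (μ∘ν (∈I a∈))) (trans (cong μ νa≡νb) (μ∘ν (∈I b∈)))

    μ-injectiveOn : InjectiveOn μ θ
    μ-injectiveOn a∈ b∈ μa≡μb = trans (sym (ν∘μ (∈I a∈))) (trans (cong ν μa≡μb) (ν∘μ (∈I b∈)))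

  μ-perm : ∀ {θ} → IsPerm n θ → IsPerm n (map μ θ)
  μ-perm {θ} θ-perm = begin
    map μ θ                                     ↭⟨ ↭.map⁺ μ (↭-trans θ-perm (↭-sym λ-perm)) ⟩
    map μ λ′                                    ≡⟨ cong (map μ) (map-app-[1…] λ′) ⟨
    map μ (map ν (map suc (upTo (length λ′)))) ≡⟨ cong (λ k → map μ (map ν (map suc (upTo k)))) length-λ ⟩
    map μ (map ν (map suc (upTo n)))            ≡⟨ map-μ∘ν ↭-refl ⟩
    map suc (upTo n)                            ∎
    where open PermutationReasoning

module Relabelling {n π λ′} (π-perm : IsPerm n π) (λ-perm : IsPerm n λ′)
                  (Pπ≡λ∘π : P π ≡ λ′ ∘ₚ π) where
  open PermutationOf λ-perm public

  ν-mono : DominanceMonotone id ν π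
  ν-mono = P-dominanceMonotone (unique-perm π-perm) Pπ≡λ∘π

  module _ (ops : List Op) {θ} (θ-perm : IsPerm n θ) (run≡π : run ops θ ≡ π) where

    private
      ν-mono-run : DominanceMonotone id ν (run ops θ)
      ν-mono-run = subst (DominanceMonotone id ν) (sym run≡π) ν-mono

    run-relabel : run ops (λ′ ∘ₚ θ) ≡ P π
    run-relabel = begin
      run ops (map ν θ)  ≡⟨ run-map ops θ (ν-injectiveOn θ-perm) ν-mono-run ⟩
      map ν (run ops θ)  ≡⟨ cong (map ν) run≡π ⟩
      map ν π            ≡⟨ Pπ≡λ∘π ⟨
      P π                ∎
      where open ≡-Reasoning

    Tin-run-relabel : ∀ {T T′} → IsTin θ T → IsTin (λ′ ∘ₚ θ) T′ → T′ ≡ relabel λ′ T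
    Tin-run-relabel tin tin′ =
      Tin-relabel tin tin′ (ν-injectiveOn θ-perm) (ν-mono-run ∘ dominates-run ops)

  relabel-injective : ∀ {θ₁ θ₂} → IsPerm n θ₁ → IsPerm n θ₂ → λ′ ∘ₚ θ₁ ≡ λ′ ∘ₚ θ₂ → θ₁ ≡ θ₂
  relabel-injective θ₁-perm θ₂-perm λθ₁≡λθ₂ =
    trans (sym (map-μ∘ν θ₁-perm)) (trans (cong (map μ) λθ₁≡λθ₂) (map-μ∘ν θ₂-perm))

  run-unrelabel : ∀ ops {θ′} → IsPerm n θ′ → run ops θ′ ≡ P π → run ops (map μ θ′) ≡ π
  run-unrelabel ops {θ′} θ′-perm run≡Pπ = begin
    run ops (map μ θ′)  ≡⟨ run-map ops θ′ (μ-injectiveOn θ′-perm) μ-mono-run ⟩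
    map μ (run ops θ′)  ≡⟨ cong (map μ) run≡λπ ⟩
    map μ (map ν π)     ≡⟨ map-μ∘ν π-perm ⟩
    π                   ∎
    where
      open ≡-Reasoning
      run≡λπ : run ops θ′ ≡ map ν π
      run≡λπ = trans run≡Pπ Pπ≡λ∘π
      μ-mono-run : DominanceMonotone id μ (run ops θ′)
      μ-mono-run = subst (DominanceMonotone id μ) (sym run≡λπ)
        (dominanceMonotone-inverse (ν-injectiveOn π-perm) ν-mono (μ∘ν ∘ ↭.∈-resp-↭ π-perm))

theorem4p8 : (ops : List Op) → RespectsP (run ops)
theorem4p8 ops n π π-perm _ _ λ′ (λ-perm , Pπ≡λ∘π) =
    (λ θ θ-perm run≡π →
       run-relabel ops θ-perm run≡π , λ T T′ → Tin-run-relabel ops θ-perm run≡π)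
  , (λ θ₁ θ₂ θ₁-perm _ θ₂-perm _ → relabel-injective θ₁-perm θ₂-perm)
  , λ θ′ θ′-perm run≡Pπ →
       map μ θ′ , μ-perm θ′-perm , run-unrelabel ops θ′-perm run≡Pπ , map-ν∘μ θ′-perm
  where open Relabelling π-perm λ-perm Pπ≡λ∘π
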